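{- Let $q$ and $r$ be positive integers and let $D$ be a $q\times q$ neighborhood constraint matrix. There is a DN formula $\varphi_{r,D}(X_1,\dots,X_q)$ such that for every graph $G$ and every tuple $(X_1,\dots,X_q)$ of vertex sets of $G$, $G\models\varphi_{r,D}(X_1,\dots,X_q)$ if and only if $(X_1,\dots,X_q)$ is a distance-$r$ $D$-partition of $G$.
   Context: For $v\in V(G)$, $N^r(v)=\{u\ne v:\mathrm{dist}_G(u,v)\le r\}$ and $N^r_d(U)=\{v:|N^r(v)\cap U|\ge d\}$ for $d,r\in\mathbb N^+$. A $q\times q$ neighborhood constraint matrix $D$ has as each entry $D[i,j]$ a non-empty finite or co-finite subset of $\mathbb N$. A vertex partition $(X_1,\dots,X_q)$ of $G$ (the $X_i$ pairwise disjoint with union $V(G)$) is a distance-$r$ $D$-partition if for all $i,j\in\{1,\dots,q\}$ and all $v\in X_i$, $|N^r(v)\cap X_j|\in D[i,j]$. DN logic: existential MSO over (vertex-colored) graphs (quantification over vertices and vertex sets; atomic $E(x,y)$, $x=y$, $x\in X$, $\mathbf P(x)$; only existential quantifiers; negation only of quantifier-free formulas) extended by size measurements $|t|=m,|t|\le m,|t|\ge m$ and comparisons $t_1=t_2$, $t_1\subseteq t_2$, $t_1\supseteq t_2$, where neighborhood terms are built from set variables, unary relation symbols, $\emptyset$ by $N^r_d(\cdot)$, complement, $\cap$, $\cup$, $\setminus$, and denote vertex sets in the obvious way. -}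

module Defs where

open import Data.Nat using (ℕ; zero; suc; _≤_; _≤ᵇ_)
open import Data.Bool using (Bool; true; false; _∧_; _∨_; not)
open import Data.Fin using (Fin)
open import Data.Fin.Properties using (_≟_)
open import Data.Fin.Subset using (Subset; _∈_; _∩_; _∪_; _─_; ∁; ⊥; ∣_∣; _⊆_)
open import Data.Vec using (Vec; tabulate; lookup)
open import Data.Product using (Σ; ∃; _×_; _,_)
open import Data.Sum using (_⊎_)
open import Relation.Nullary using (¬_)
open import Relation.Nullary.Decidable using (⌊_⌋)
open import Relation.Binary.PropositionalEquality using (_≡_)

record Graph (c n : ℕ) : Set where
  field
    E      : Fin n → Fin n → Bool
    E-sym  : ∀ u v → E u v ≡ E v u
    E-irr  : ∀ v → E v v ≡ false
    P      : Fin c → Fin n → Bool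
open Graph public

anyFin : ∀ {n} → (Fin n → Bool) → Bool
anyFin {zero}  f = false
anyFin {suc n} f = f Fin.zero ∨ anyFin (λ i → f (Fin.suc i))

within : ∀ {c n} → Graph c n → ℕ → Fin n → Fin n → Bool
within G zero    u v = ⌊ u ≟ v ⌋
within G (suc r) u v = within G r u v ∨ anyFin (λ w → E G u w ∧ within G r w v)

Nr : ∀ {c n} → Graph c n → ℕ → Fin n → Subset n
Nr G r v = tabulate (λ u → not ⌊ u ≟ v ⌋ ∧ within G r v u)

Nrd : ∀ {c n} → Graph c n → ℕ → ℕ → Subset n → Subset n
Nrd G r d U = tabulate (λ v → d ≤ᵇ ∣ Nr G r v ∩ U ∣)

FinOrCofin : (ℕ → Bool) → Set
FinOrCofin S = Σ ℕ (λ b → (∀ m → b ≤ m → S m ≡ false) ⊎ (∀ m → b ≤ m → S m ≡ true))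

NonEmpty : (ℕ → Bool) → Set
NonEmpty S = Σ ℕ (λ m → S m ≡ true)

IsNCM : ∀ q → (Fin q → Fin q → ℕ → Bool) → Set
IsNCM q D = ∀ i j → NonEmpty (D i j) × FinOrCofin (D i j)

IsPartition : ∀ {n q} → (Fin q → Subset n) → Set
IsPartition {n} {q} X =
  (∀ (v : Fin n) → ∃ (λ i → v ∈ X i)) ×
  (∀ (v : Fin n) i j → v ∈ X i → v ∈ X j → i ≡ j)

IsDPartition : ∀ {c n q} → Graph c n → ℕ → (Fin q → Fin q → ℕ → Bool) →
               (Fin q → Subset n) → Set
IsDPartition {c} {n} {q} G r D X =
  IsPartition X ×
  (∀ (i j : Fin q) (v : Fin n) → v ∈ X i → D i j ∣ Nr G r v ∩ X j ∣ ≡ true)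

-- DN logic: syntax
-- c : number of unary relation symbols, nv / ns : number of vertex / set
-- variables in scope (de Bruijn style, variables are Fin-indices)

data Term (c ns : ℕ) : Set where
  svar  : Fin ns → Term c ns
  rel   : Fin c → Term c ns
  empty : Term c ns
  nbh   : (r d : ℕ) → 1 ≤ r → 1 ≤ d → Term c ns → Term c ns
  compl : Term c ns → Term c ns
  _∩ₜ_  : Term c ns → Term c ns → Term c ns
  _∪ₜ_  : Term c ns → Term c ns → Term c ns
  _∖ₜ_  : Term c ns → Term c ns → Term c ns

data QF (c nv ns : ℕ) : Set where
  edge    : Fin nv → Fin nv → QF c nv ns
  eqv     : Fin nv → Fin nv → QF c nv ns
  mem     : Fin nv → Fin ns → QF c nv ns
  pred    : Fin c → Fin nv → QF c nv ns
  size=   : Term c ns → ℕ → QF c nv ns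
  size≤   : Term c ns → ℕ → QF c nv ns
  size≥   : Term c ns → ℕ → QF c nv ns
  teq     : Term c ns → Term c ns → QF c nv ns
  tsub    : Term c ns → Term c ns → QF c nv ns
  tsup    : Term c ns → Term c ns → QF c nv ns
  neg     : QF c nv ns → QF c nv ns
  andq    : QF c nv ns → QF c nv ns → QF c nv ns
  orq     : QF c nv ns → QF c nv ns → QF c nv ns

data DN (c : ℕ) : ℕ → ℕ → Set where
  qf    : ∀ {nv ns} → QF c nv ns → DN c nv ns
  and   : ∀ {nv ns} → DN c nv ns → DN c nv ns → DN c nv ns
  or    : ∀ {nv ns} → DN c nv ns → DN c nv ns → DN c nv ns
  exV   : ∀ {nv ns} → DN c (suc nv) ns → DN c nv ns
  exS   : ∀ {nv ns} → DN c nv (suc ns) → DN c nv ns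

extend : ∀ {k} {A : Set} → (Fin k → A) → A → Fin (suc k) → A
extend ρ a Fin.zero    = a
extend ρ a (Fin.suc i) = ρ i

⟦_⟧ₜ : ∀ {c n ns} → Term c ns → Graph c n → (Fin ns → Subset n) → Subset n
⟦ svar X ⟧ₜ G σ = σ X
⟦ rel p ⟧ₜ G σ = tabulate (P G p)
⟦ empty ⟧ₜ G σ = ⊥
⟦ nbh r d _ _ t ⟧ₜ G σ = Nrd G r d (⟦ t ⟧ₜ G σ)
⟦ compl t ⟧ₜ G σ = ∁ (⟦ t ⟧ₜ G σ)
⟦ t ∩ₜ s ⟧ₜ G σ = ⟦ t ⟧ₜ G σ ∩ ⟦ s ⟧ₜ G σ
⟦ t ∪ₜ s ⟧ₜ G σ = ⟦ t ⟧ₜ G σ ∪ ⟦ s ⟧ₜ G σ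
⟦ t ∖ₜ s ⟧ₜ G σ = ⟦ t ⟧ₜ G σ ─ ⟦ s ⟧ₜ G σ

SatQF : ∀ {c n nv ns} → Graph c n → QF c nv ns →
        (Fin nv → Fin n) → (Fin ns → Subset n) → Set
SatQF G (edge x y) ρ σ = E G (ρ x) (ρ y) ≡ true
SatQF G (eqv x y) ρ σ = ρ x ≡ ρ y
SatQF G (mem x X) ρ σ = ρ x ∈ σ X
SatQF G (pred p x) ρ σ = P G p (ρ x) ≡ true
SatQF G (size= t m) ρ σ = ∣ ⟦ t ⟧ₜ G σ ∣ ≡ m
SatQF G (size≤ t m) ρ σ = ∣ ⟦ t ⟧ₜ G σ ∣ ≤ m
SatQF G (size≥ t m) ρ σ = m ≤ ∣ ⟦ t ⟧ₜ G σ ∣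
SatQF G (teq t s) ρ σ = ⟦ t ⟧ₜ G σ ≡ ⟦ s ⟧ₜ G σ
SatQF G (tsub t s) ρ σ = ⟦ t ⟧ₜ G σ ⊆ ⟦ s ⟧ₜ G σ
SatQF G (tsup t s) ρ σ = ⟦ s ⟧ₜ G σ ⊆ ⟦ t ⟧ₜ G σ
SatQF G (neg φ) ρ σ = ¬ SatQF G φ ρ σ
SatQF G (andq φ ψ) ρ σ = SatQF G φ ρ σ × SatQF G ψ ρ σ
SatQF G (orq φ ψ) ρ σ = SatQF G φ ρ σ ⊎ SatQF G ψ ρ σ

Sat : ∀ {c n nv ns} → Graph c n → DN c nv ns →
      (Fin nv → Fin n) → (Fin ns → Subset n) → Set
Sat G (qf φ) ρ σ = SatQF G φ ρ σ
Sat G (and φ ψ) ρ σ = Sat G φ ρ σ × Sat G ψ ρ σ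
Sat G (or φ ψ) ρ σ = Sat G φ ρ σ ⊎ Sat G ψ ρ σ
Sat {n = n} G (exV φ) ρ σ = Σ (Fin n) (λ u → Sat G φ (extend ρ u) σ)
Sat {n = n} G (exS φ) ρ σ = Σ (Subset n) (λ U → Sat G φ ρ (extend σ U))

noVars : ∀ {n} → Fin 0 → Fin n
noVars ()

{-# OPTIONS --safe #-}
-- The formula is quantifier-free: X covers V, the X_i are pairwise disjoint, and
-- X_i ⊆ A_ij for the neighborhood term A_ij selecting the vertices v with
-- |N^r(v) ∩ X_j| ∈ D[i,j].  Such a term exists because D[i,j] is finite or
-- co-finite with some bound b: "exactly m" is N^r_m(X_j) ∖ N^r_(m+1)(X_j), so
-- A_ij is the union of "exactly m" over the m < b in D[i,j], together with
-- N^r_b(X_j) in the co-finite case.  Non-emptiness of the entries of D is not needed.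
module Submission where

open import Defs
open import Data.Nat using (ℕ; zero; suc; _≤_; _<_; z≤n; s≤s)
open import Data.Nat.Properties using (≤ᵇ⇒≤; ≤⇒≤ᵇ; ≤-antisym; ≤-reflexive; n≮n; ≮⇒≥; _<?_)
open import Data.Bool using (Bool; true; false; T)
open import Data.Bool.Properties using (T-≡)
open import Data.Fin using (Fin; toℕ; fromℕ<)
open import Data.Fin.Properties using (_≟_; toℕ<n; toℕ-fromℕ<)
open import Data.Fin.Subset using (Subset; outside; _∈_; _∉_; _∩_; _∪_; _─_; ∁; ⊥; ∣_∣)
open import Data.Fin.Subset.Properties
  using (∉⊥; x∉p⇒x∈∁p; x∈p∩q⁺; x∈p∩q⁻; x∈p∪q⁺; x∈p∪q⁻; x∈p∧x∉q⇒x∈p─q; p─q⊆p)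
open import Data.Vec using (_∷_; tabulate; here; there)
open import Data.Vec.Properties using (lookup∘tabulate; []=⇒lookup; lookup⇒[]=)
open import Data.Product using (Σ; ∃; _×_; _,_; proj₂)
open import Data.Sum using (_⊎_; inj₁; inj₂; [_,_]′)
open import Data.Empty using (⊥-elim)
open import Function using (_∘_)
open import Function.Bundles using (_⇔_; mk⇔; Equivalence)
open import Relation.Nullary using (yes; no; contradiction)
open import Relation.Binary.PropositionalEquality using (_≡_; refl; sym; trans; subst)

open Equivalence using (to; from)

x∈tabulate⇔ : ∀ {n} {f : Fin n → Bool} {x : Fin n} → x ∈ tabulate f ⇔ T (f x)
x∈tabulate⇔ {f = f} {x} = mk⇔
  (λ x∈ → from T-≡ (trans (sym (lookup∘tabulate f x)) ([]=⇒lookup x∈)))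
  (λ fx → lookup⇒[]= x (tabulate f) (trans (lookup∘tabulate f x) (to T-≡ fx)))

x∈p─q⇒x∉q : ∀ {n} {p q : Subset n} {x : Fin n} → x ∈ p ─ q → x ∉ q
x∈p─q⇒x∉q {p = _ ∷ _} {outside ∷ _} here        ()
x∈p─q⇒x∉q {p = _ ∷ _} {_ ∷ _}       (there x∈) (there x∈q) = x∈p─q⇒x∉q x∈ x∈q

nbhCount : ∀ {c n} → Graph c n → ℕ → Subset n → Fin n → ℕ
nbhCount G r U v = ∣ Nr G r v ∩ U ∣

x∈Nrd⇔ : ∀ {c n} {G : Graph c n} {r d U v} → v ∈ Nrd G r d U ⇔ d ≤ nbhCount G r U v
x∈Nrd⇔ = mk⇔ (≤ᵇ⇒≤ _ _ ∘ to x∈tabulate⇔) (from x∈tabulate⇔ ∘ ≤⇒≤ᵇ)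

⋃ₜ : ∀ {c ns k} → (Fin k → Term c ns) → Term c ns
⋃ₜ {k = zero}  f = empty
⋃ₜ {k = suc k} f = f Fin.zero ∪ₜ ⋃ₜ (f ∘ Fin.suc)

when : ∀ {c ns} → Bool → Term c ns → Term c ns
when true  t = t
when false t = empty

-- N^r_0 is not a term (d ≥ 1 is required), but "at least 0" is the complement of ∅.
atLeast : ∀ {c ns} (r : ℕ) → 1 ≤ r → ℕ → Term c ns → Term c ns
atLeast r hr zero    t = compl empty
atLeast r hr (suc m) t = nbh r (suc m) hr (s≤s z≤n) t

exactly : ∀ {c ns} (r : ℕ) → 1 ≤ r → ℕ → Term c ns → Term c ns
exactly r hr m t = atLeast r hr m t ∖ₜ atLeast r hr (suc m) t

countBelow : ∀ {c ns} (r : ℕ) → 1 ≤ r → (ℕ → Bool) → ℕ → Term c ns → Term c ns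
countBelow r hr S b t = ⋃ₜ {k = b} λ m → when (S (toℕ m)) (exactly r hr (toℕ m) t)

countIn : ∀ {c ns} (r : ℕ) → 1 ≤ r → (S : ℕ → Bool) → FinOrCofin S → Term c ns → Term c ns
countIn r hr S (b , inj₁ _) t = countBelow r hr S b t
countIn r hr S (b , inj₂ _) t = countBelow r hr S b t ∪ₜ atLeast r hr b t

module _ {c n ns} (G : Graph c n) (σ : Fin ns → Subset n) where

  x∈⋃ₜ⇔ : ∀ {k} {f : Fin k → Term c ns} {v} → v ∈ ⟦ ⋃ₜ f ⟧ₜ G σ ⇔ ∃ λ i → v ∈ ⟦ f i ⟧ₜ G σ
  x∈⋃ₜ⇔ {zero}        = mk⇔ (⊥-elim ∘ ∉⊥) λ ()
  x∈⋃ₜ⇔ {suc k} {f} = mk⇔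
    (λ v∈ → case-∪ (x∈p∪q⁻ (⟦ f Fin.zero ⟧ₜ G σ) (⟦ ⋃ₜ (f ∘ Fin.suc) ⟧ₜ G σ) v∈))
    λ { (Fin.zero , v∈) → x∈p∪q⁺ (inj₁ v∈)
      ; (Fin.suc i , v∈) → x∈p∪q⁺ (inj₂ (from x∈⋃ₜ⇔ (i , v∈))) }
    where
    case-∪ : ∀ {v} → v ∈ ⟦ f Fin.zero ⟧ₜ G σ ⊎ v ∈ ⟦ ⋃ₜ (f ∘ Fin.suc) ⟧ₜ G σ →
             ∃ λ i → v ∈ ⟦ f i ⟧ₜ G σ
    case-∪ (inj₁ v∈) = Fin.zero , v∈
    case-∪ (inj₂ v∈) = let i , v∈′ = to x∈⋃ₜ⇔ v∈ in Fin.suc i , v∈′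

  x∈when⇔ : ∀ {b t v} → v ∈ ⟦ when b t ⟧ₜ G σ ⇔ (b ≡ true × v ∈ ⟦ t ⟧ₜ G σ)
  x∈when⇔ {true}  = mk⇔ (refl ,_) proj₂
  x∈when⇔ {false} = mk⇔ (⊥-elim ∘ ∉⊥) λ ()

  module _ {r : ℕ} (hr : 1 ≤ r) where

    count : Term c ns → Fin n → ℕ
    count t = nbhCount G r (⟦ t ⟧ₜ G σ)

    x∈atLeast⇔ : ∀ {m t v} → v ∈ ⟦ atLeast r hr m t ⟧ₜ G σ ⇔ m ≤ count t v
    x∈atLeast⇔ {zero}  = mk⇔ (λ _ → z≤n) (λ _ → x∉p⇒x∈∁p ∉⊥)
    x∈atLeast⇔ {suc m} = x∈Nrd⇔ {G = G} {r}

    x∈exactly⇔ : ∀ {m t v} → v ∈ ⟦ exactly r hr m t ⟧ₜ G σ ⇔ count t v ≡ m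
    x∈exactly⇔ {m} {t} {v} = mk⇔
      (λ v∈ → ≤-antisym
        (≮⇒≥ (x∈p─q⇒x∉q v∈ ∘ from (x∈atLeast⇔ {suc m} {t})))
        (to (x∈atLeast⇔ {m} {t}) (p─q⊆p (⟦ atLeast r hr m t ⟧ₜ G σ) _ v∈)))
      λ count≡m → x∈p∧x∉q⇒x∈p─q (from (x∈atLeast⇔ {m} {t}) (≤-reflexive (sym count≡m)))
        (n≮n m ∘ subst (m <_) count≡m ∘ to (x∈atLeast⇔ {suc m} {t}))

    x∈countBelow⇔ : ∀ {S b t v} →
      v ∈ ⟦ countBelow r hr S b t ⟧ₜ G σ ⇔ (count t v < b × S (count t v) ≡ true)
    x∈countBelow⇔ {S} {b} {t} {v} = mk⇔
      (λ v∈ → let i , v∈i = to (x∈⋃ₜ⇔ {f = cell}) v∈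
                  S-i , v∈exactly = to (x∈when⇔ {S (toℕ i)}) v∈i
                  count≡i = to (x∈exactly⇔ {toℕ i} {t}) v∈exactly
              in subst (_< b) (sym count≡i) (toℕ<n i) ,
                 subst (λ k → S k ≡ true) (sym count≡i) S-i)
      (λ (count<b , S-count) →
         let i = fromℕ< count<b
             i≡count = toℕ-fromℕ< count<b
         in from (x∈⋃ₜ⇔ {f = cell}) (i , from (x∈when⇔ {S (toℕ i)})
              (subst (λ k → S k ≡ true) (sym i≡count) S-count ,
               from (x∈exactly⇔ {toℕ i} {t}) (sym i≡count))))
      where
      cell : Fin b → Term c ns
      cell m = when (S (toℕ m)) (exactly r hr (toℕ m) t)

    x∈countIn⇔ : ∀ {S} (fc : FinOrCofin S) {t v} →
      v ∈ ⟦ countIn r hr S fc t ⟧ₜ G σ ⇔ S (count t v) ≡ true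
    x∈countIn⇔ {S} (b , inj₁ finite) {t} {v} =
      mk⇔ (proj₂ ∘ to (x∈countBelow⇔ {S} {b} {t}))
          (λ S-count → from (x∈countBelow⇔ {S} {b} {t}) (count<b S-count , S-count))
      where
      count<b : S (count t v) ≡ true → count t v < b
      count<b S-count with count t v <? b
      ... | yes count<b = count<b
      ... | no  count≮b with () ← trans (sym S-count) (finite _ (≮⇒≥ count≮b))
    x∈countIn⇔ {S} (b , inj₂ cofinite) {t} {v} = mk⇔
      (λ v∈ → [ proj₂ ∘ to (x∈countBelow⇔ {S} {b} {t}) , cofinite _ ∘ to (x∈atLeast⇔ {b} {t}) ]′
                (x∈p∪q⁻ (⟦ countBelow r hr S b t ⟧ₜ G σ) _ v∈))
      (x∈p∪q⁺ ∘ split)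
      where
      split : S (count t v) ≡ true →
              v ∈ ⟦ countBelow r hr S b t ⟧ₜ G σ ⊎ v ∈ ⟦ atLeast r hr b t ⟧ₜ G σ
      split S-count with count t v <? b
      ... | yes count<b = inj₁ (from (x∈countBelow⇔ {S} {b} {t}) (count<b , S-count))
      ... | no  count≮b = inj₂ (from (x∈atLeast⇔ {b} {t}) (≮⇒≥ count≮b))

⊤ᶠ : ∀ {c nv ns} → DN c nv ns
⊤ᶠ = qf (tsub empty empty)

⋀ᶠ : ∀ {c nv ns k} → (Fin k → DN c nv ns) → DN c nv ns
⋀ᶠ {k = zero}  φ = ⊤ᶠ
⋀ᶠ {k = suc k} φ = and (φ Fin.zero) (⋀ᶠ (φ ∘ Fin.suc))

module _ {c n nv ns} (G : Graph c n) (ρ : Fin nv → Fin n) (σ : Fin ns → Subset n) where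

  Sat-⋀ᶠ⇔ : ∀ {k} {φ : Fin k → DN c nv ns} → Sat G (⋀ᶠ φ) ρ σ ⇔ (∀ i → Sat G (φ i) ρ σ)
  Sat-⋀ᶠ⇔ {zero}      = mk⇔ (λ _ ()) (λ _ {_} v∈ → v∈)
  Sat-⋀ᶠ⇔ {suc k} {φ} = mk⇔
    (λ (sat₀ , sats) → λ { Fin.zero → sat₀ ; (Fin.suc i) → to Sat-⋀ᶠ⇔ sats i })
    (λ sat → sat Fin.zero , from Sat-⋀ᶠ⇔ (sat ∘ Fin.suc))

  Sat-⋀ᶠ²⇔ : ∀ {k l} {φ : Fin k → Fin l → DN c nv ns} →
    Sat G (⋀ᶠ λ i → ⋀ᶠ (φ i)) ρ σ ⇔ (∀ i j → Sat G (φ i j) ρ σ)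
  Sat-⋀ᶠ²⇔ = mk⇔ (λ sat i → to Sat-⋀ᶠ⇔ (to Sat-⋀ᶠ⇔ sat i))
                 (λ sat → from Sat-⋀ᶠ⇔ λ i → from Sat-⋀ᶠ⇔ (sat i))

coversᶠ : ∀ {c nv q} → DN c nv q
coversᶠ = qf (tsub (compl empty) (⋃ₜ svar))

disjointᶠ : ∀ {c nv q} → Fin q → Fin q → DN c nv q
disjointᶠ i j with i ≟ j
... | yes _ = ⊤ᶠ
... | no  _ = qf (tsub (svar i ∩ₜ svar j) empty)

constraintᶠ : ∀ {c nv q} (r : ℕ) → 1 ≤ r → (D : Fin q → Fin q → ℕ → Bool) →
              (∀ i j → FinOrCofin (D i j)) → Fin q → Fin q → DN c nv q
constraintᶠ r hr D fc i j = qf (tsub (svar i) (countIn r hr (D i j) (fc i j) (svar j)))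

DPartitionᶠ : ∀ {c nv q} (r : ℕ) → 1 ≤ r → (D : Fin q → Fin q → ℕ → Bool) →
              (∀ i j → FinOrCofin (D i j)) → DN c nv q
DPartitionᶠ r hr D fc =
  and coversᶠ (and (⋀ᶠ λ i → ⋀ᶠ (disjointᶠ i)) (⋀ᶠ λ i → ⋀ᶠ (constraintᶠ r hr D fc i)))

module _ {c n nv q} (G : Graph c n) (ρ : Fin nv → Fin n) (X : Fin q → Subset n) where

  Sat-coversᶠ⇔ : Sat G coversᶠ ρ X ⇔ (∀ v → ∃ λ i → v ∈ X i)
  Sat-coversᶠ⇔ = mk⇔ (λ sat v → to (x∈⋃ₜ⇔ G X) (sat (x∉p⇒x∈∁p ∉⊥)))
                     (λ covers {v} _ → from (x∈⋃ₜ⇔ G X) (covers v))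

  Sat-disjointᶠ⇔ : ∀ i j → Sat G (disjointᶠ i j) ρ X ⇔ (∀ v → v ∈ X i → v ∈ X j → i ≡ j)
  Sat-disjointᶠ⇔ i j with i ≟ j
  ... | yes i≡j = mk⇔ (λ _ _ _ _ → i≡j) (λ _ {_} v∈ → v∈)
  ... | no  i≢j = mk⇔ (λ sat v v∈i v∈j → ⊥-elim (∉⊥ (sat (x∈p∩q⁺ (v∈i , v∈j)))))
                      (λ disjoint {_} v∈ → let v∈i , v∈j = x∈p∩q⁻ (X i) (X j) v∈ in
                                       contradiction (disjoint _ v∈i v∈j) i≢j)

  Sat-constraintᶠ⇔ : ∀ {r} (hr : 1 ≤ r) D fc i j →
    Sat G (constraintᶠ r hr D fc i j) ρ X ⇔ (∀ v → v ∈ X i → D i j (nbhCount G r (X j) v) ≡ true)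
  Sat-constraintᶠ⇔ hr D fc i j = mk⇔
    (λ sat v v∈i → to (x∈countIn⇔ G X hr (fc i j)) (sat v∈i))
    (λ constraint {v} v∈i → from (x∈countIn⇔ G X hr (fc i j)) (constraint v v∈i))

  Sat-DPartitionᶠ⇔ : ∀ {r} (hr : 1 ≤ r) D fc →
    Sat G (DPartitionᶠ r hr D fc) ρ X ⇔ IsDPartition G r D X
  Sat-DPartitionᶠ⇔ hr D fc = mk⇔
    (λ (covers , disjoint , constraint) →
      (to Sat-coversᶠ⇔ covers ,
       λ v i j → to (Sat-disjointᶠ⇔ i j) (to (Sat-⋀ᶠ²⇔ G ρ X) disjoint i j) v) ,
      λ i j → to (Sat-constraintᶠ⇔ hr D fc i j) (to (Sat-⋀ᶠ²⇔ G ρ X) constraint i j))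
    (λ ((covers , disjoint) , constraint) →
      from Sat-coversᶠ⇔ covers ,
      from (Sat-⋀ᶠ²⇔ G ρ X {φ = disjointᶠ})
           (λ i j → from (Sat-disjointᶠ⇔ i j) λ v → disjoint v i j) ,
      from (Sat-⋀ᶠ²⇔ G ρ X {φ = constraintᶠ _ hr D fc})
           (λ i j → from (Sat-constraintᶠ⇔ hr D fc i j) (constraint i j)))

proposition6p4 : (q r : ℕ) → 1 ≤ q → 1 ≤ r →
    (D : Fin q → Fin q → ℕ → Bool) → IsNCM q D →
    (c : ℕ) → Σ (DN c 0 q) (λ φ →
      ∀ {n} (G : Graph c n) (X : Fin q → Subset n) →
        (Sat G φ noVars X → IsDPartition G r D X) ×
        (IsDPartition G r D X → Sat G φ noVars X))
proposition6p4 q r _ hr D ncm c =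
  DPartitionᶠ r hr D finOrCofin , λ G X →
    let sat⇔ = Sat-DPartitionᶠ⇔ G noVars X hr D finOrCofin in to sat⇔ , from sat⇔
  where
  finOrCofin : ∀ i j → FinOrCofin (D i j)
  finOrCofin i j = proj₂ (ncm i j)
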